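{- For positive integers $t,s$ and $i\in\{1,2\}$, $\dim(G_i[K_1,K_t,K_s])=s+t-1$.
   Context: $\partial(x,y)$ is the length of a shortest directed path from $x$ to $y$, $\tilde\partial(x,y)=(\partial(x,y),\partial(y,x))$. A vertex set $\{w_1,\dots,w_m\}$ is weakly resolving if $(\tilde\partial(w_1,u),\dots,\tilde\partial(w_m,u))\neq(\tilde\partial(w_1,v),\dots,\tilde\partial(w_m,v))$ for all distinct $u,v$; $\dim$ (weak metric dimension) is the minimum size of such a set. $K_t$ is the complete digraph on $t$ vertices. $G_1$ is the digraph on $\{0,1,2\}$ with arcs $(0,1),(1,2),(2,1),(2,0)$; $G_2$ is the digraph on $\{0,1,2\}$ with arcs $(0,1),(1,0),(1,2),(2,1),(2,0)$. For a digraph $G$ on $\{0,\dots,m-1\}$ and vertex-disjoint digraphs $H_0,\dots,H_{m-1}$, $G[H_0,\dots,H_{m-1}]$ has vertex set $\bigcup V(H_i)$, and for $x\in V(H_i)$, $y\in V(H_j)$, $(x,y)$ is an arc iff either $i=j$ and $(x,y)$ is an arc of $H_i$, or $i\neq j$ and $(i,j)$ is an arc of $G$. -}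

module Defs where

open import Data.Nat using (ℕ; zero; suc; _+_; _≤_; _∸_)
open import Data.Fin using (Fin; zero; suc)
open import Data.Fin.Properties using () renaming (_≟_ to _≟F_)
open import Data.Bool using (Bool; true; false; _∧_; not; if_then_else_)
open import Data.Bool.ListAction using (any)
open import Data.List using (List; []; _∷_; length; allFin; concatMap; map)
open import Data.List.Membership.Propositional using (_∈_; lose)
open import Data.List.Membership.Propositional.Properties using (∈-allFin; ∈-concatMap⁺; ∈-map⁺)
open import Data.List.Relation.Unary.All using (All)
open import Data.List.Relation.Unary.Any using (Any)
open import Data.List.Relation.Unary.Unique.Propositional using (Unique)
open import Data.Maybe using (Maybe; just; nothing)
open import Data.Product using (Σ; _,_; _×_; ∃-syntax)
open import Data.Product.Properties using (≡-dec)
open import Relation.Binary.Definitions using (DecidableEquality)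
open import Relation.Binary.PropositionalEquality using (_≡_; _≢_; refl)
open import Relation.Nullary using (¬_; yes; no)
open import Relation.Nullary.Decidable using (⌊_⌋)

record FDigraph : Set₁ where
  field
    V        : Set
    _≟_      : DecidableEquality V
    allV     : List V
    complete : ∀ v → v ∈ allV
    arc      : V → V → Bool

  walk : ℕ → V → V → Bool
  walk zero    x y = ⌊ x ≟ y ⌋
  walk (suc k) x y = any (λ z → arc x z ∧ walk k z y) allV

  private
    search : ℕ → ℕ → (ℕ → Bool) → Maybe ℕ
    search zero     k p = nothing
    search (suc b)  k p = if p k then just k else search b (suc k) p

  -- ∂(x,y): length of a shortest directed path from x to y
  -- (nothing = no path, i.e. ∂ = ∞).  A shortest walk is a path and has
  -- length < |V|, so searching lengths 0 .. |V|-1 suffices.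
  ∂ : V → V → Maybe ℕ
  ∂ x y = search (length allV) 0 (λ k → walk k x y)

  ∂̃ : V → V → Maybe ℕ × Maybe ℕ
  ∂̃ x y = ∂ x y , ∂ y x

  WeaklyResolving : List V → Set
  WeaklyResolving W = ∀ u v → u ≢ v → ¬ All (λ w → ∂̃ w u ≡ ∂̃ w v) W

  WeakMetricDim≡ : ℕ → Set
  WeakMetricDim≡ d =
    (∃[ W ] (Unique W × WeaklyResolving W × length W ≡ d))
    × (∀ W → Unique W → WeaklyResolving W → d ≤ length W)

open FDigraph public

FinDigraph : ℕ → Set
FinDigraph n = Fin n → Fin n → Bool

toFD : ∀ {n} → FinDigraph n → FDigraph
toFD {n} a = record
  { V = Fin n ; _≟_ = _≟F_ ; allV = allFin n ; complete = ∈-allFin ; arc = a }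

K : (t : ℕ) → FinDigraph t
K t x y = not ⌊ x ≟F y ⌋

G₁ : FinDigraph 3
G₁ zero (suc zero) = true
G₁ (suc zero) (suc (suc zero)) = true
G₁ (suc (suc zero)) (suc zero) = true
G₁ (suc (suc zero)) zero = true
G₁ _ _ = false

G₂ : FinDigraph 3
G₂ zero (suc zero) = true
G₂ (suc zero) zero = true
G₂ (suc zero) (suc (suc zero)) = true
G₂ (suc (suc zero)) (suc zero) = true
G₂ (suc (suc zero)) zero = true
G₂ _ _ = false

private
  allΣ : ∀ m (ns : Fin m → ℕ) → List (Σ (Fin m) (λ i → Fin (ns i)))
  allΣ m ns = concatMap (λ i → map (i ,_) (allFin (ns i))) (allFin m)

  completeΣ : ∀ m (ns : Fin m → ℕ) v → v ∈ allΣ m ns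
  completeΣ m ns (i , x) =
    ∈-concatMap⁺ (λ j → map (j ,_) (allFin (ns j))) (lose (∈-allFin i) (∈-map⁺ (i ,_) (∈-allFin x)))

_[_] : ∀ {m} → FinDigraph m → ((i : Fin m) → Σ ℕ FinDigraph) → FDigraph
_[_] {m} G H = record
  { V        = Σ (Fin m) (λ i → Fin (ns i))
  ; _≟_      = ≡-dec _≟F_ _≟F_
  ; allV     = allΣ m ns
  ; complete = completeΣ m ns
  ; arc      = a
  }
  where
  ns : Fin m → ℕ
  ns i = Data.Product.proj₁ (H i)
  a : Σ (Fin m) (λ i → Fin (ns i)) → Σ (Fin m) (λ i → Fin (ns i)) → Bool
  a (i , x) (j , y) with i ≟F j
  ... | yes refl = Data.Product.proj₂ (H i) x y
  ... | no _     = G i j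

_[K₁,K_,K_] : FinDigraph 3 → ℕ → ℕ → FDigraph
G [K₁,K t ,K s ] = G [ H ]
  where
  H : Fin 3 → Σ ℕ FinDigraph
  H zero             = 1 , K 1
  H (suc zero)       = t , K t
  H (suc (suc zero)) = s , K s

module Submission where

-- Distances between distinct vertices of G[K₁,K_t,K_s] depend only on their classes, and away
-- from the apex K₁ the digraph is complete.  Hence two vertices of one class are told apart only
-- by themselves, and a vertex of K_t and one of K_s only by themselves and the apex, so a weakly
-- resolving set misses at most two vertices.  Conversely, all vertices but the apex and one
-- vertex b of K_t form a weakly resolving set: a vertex of K_s is reached from the apex in two
-- steps but from b in one.

open import Defs
open import Data.Nat using (ℕ; zero; suc; _+_; _∸_; _≤_; z≤n; s≤s; s≤s⁻¹)
open import Data.Nat.Properties using (+-monoʳ-≤; +-suc; +-comm)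
open import Data.Fin using (Fin; zero; suc)
open import Data.Bool using (true; false; T; if_then_else_)
open import Data.Bool.Properties using (T-∧)
open import Data.Empty using (⊥; ⊥-elim)
open import Data.Sum as Sum using (_⊎_; inj₁; inj₂)
open import Data.List using (List; []; _∷_; _++_; length; filter; tabulate)
open import Data.List.Properties using (length-++; length-removeAt′; length-tabulate)
open import Data.List.Membership.Propositional using (_∈_; _∉_; _─_; lose)
open import Data.List.Membership.Propositional.Properties using (∈-++⁺ˡ; ∈-++⁺ʳ; ∈-++⁻; ∈-filter⁺; ∈-tabulate⁺; ∈-tabulate⁻)
open import Data.List.Relation.Binary.Subset.Propositional using (_⊆_)
open import Data.List.Relation.Unary.All as All using (All; []; _∷_)
open import Data.List.Relation.Unary.All.Properties using (all-filter; ¬Any⇒All¬)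
open import Data.List.Relation.Unary.Any using (here; there; index; satisfied)
open import Data.List.Relation.Unary.Any.Properties using (any⁺; any⁻)
open import Data.List.Relation.Unary.Unique.Propositional using (Unique; []; _∷_)
open import Data.List.Relation.Unary.Unique.Propositional.Properties using (filter⁺; ++⁺; tabulate⁺)
open import Data.Maybe using (just)
open import Data.Maybe.Properties using (just-injective)
open import Data.List.Relation.Binary.Disjoint.Propositional using (Disjoint)
open import Data.Product using (∃-syntax; _,_; proj₁; proj₂)
open import Function using (Equivalence; _∘_)
open import Relation.Binary.Definitions using (DecidableEquality)
open import Relation.Binary.PropositionalEquality
open import Relation.Nullary using (¬_; yes; no; ¬?)
open import Relation.Nullary.Decidable using (fromWitness; fromWitnessFalse; toWitness)

module _ {A : Set} where

  ∈-─⁺ : ∀ {x z : A} {ys} (x∈ys : x ∈ ys) → z ∈ ys → z ≢ x → z ∈ ys ─ x∈ys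
  ∈-─⁺ (here refl) (here z≡x) z≢x = ⊥-elim (z≢x z≡x)
  ∈-─⁺ (here refl) (there z∈ys) _ = z∈ys
  ∈-─⁺ (there _) (here refl) _ = here refl
  ∈-─⁺ (there x∈ys) (there z∈ys) z≢x = there (∈-─⁺ x∈ys z∈ys z≢x)

  Unique-⊆⇒length-≤ : ∀ {xs ys : List A} → Unique xs → xs ⊆ ys → length xs ≤ length ys
  Unique-⊆⇒length-≤ {[]} _ _ = z≤n
  Unique-⊆⇒length-≤ {x ∷ xs} {ys} (x∉xs ∷ uxs) xxs⊆ys = begin
    suc (length xs)          ≤⟨ s≤s (Unique-⊆⇒length-≤ uxs xs⊆ys─x) ⟩
    suc (length (ys ─ x∈ys)) ≡⟨ sym (length-removeAt′ ys (index x∈ys)) ⟩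
    length ys                ∎
    where
    open Data.Nat.Properties.≤-Reasoning
    x∈ys = xxs⊆ys (here refl)
    xs⊆ys─x : xs ⊆ ys ─ x∈ys
    xs⊆ys─x z∈xs = ∈-─⁺ x∈ys (xxs⊆ys (there z∈xs)) (≢-sym (All.lookup x∉xs z∈xs))

  no-three⇒length≤2 : {P : A → Set} →
    (∀ {x y z} → x ≢ y → x ≢ z → y ≢ z → P x → P y → P z → ⊥) →
    ∀ {xs} → Unique xs → All P xs → length xs ≤ 2
  no-three⇒length≤2 _ {[]} _ _ = z≤n
  no-three⇒length≤2 _ {_ ∷ []} _ _ = s≤s z≤n
  no-three⇒length≤2 _ {_ ∷ _ ∷ []} _ _ = s≤s (s≤s z≤n)
  no-three⇒length≤2 no-three {_ ∷ _ ∷ _ ∷ _} ((x≢y ∷ x≢z ∷ _) ∷ (y≢z ∷ _) ∷ _) (px ∷ py ∷ pz ∷ _) =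
    ⊥-elim (no-three x≢y x≢z y≢z px py pz)

  length≤length+complement : (_≟_ : DecidableEquality A) {k : ℕ} (xs ys : List A) → Unique xs →
    (∀ {zs} → Unique zs → All (_∉ ys) zs → length zs ≤ k) → length xs ≤ length ys + k
  length≤length+complement _≟_ {k} xs ys uxs bound = begin
    length xs                   ≤⟨ Unique-⊆⇒length-≤ uxs xs⊆ys++rest ⟩
    length (ys ++ rest)         ≡⟨ length-++ ys ⟩
    length ys + length rest     ≤⟨ +-monoʳ-≤ (length ys) (bound (filter⁺ ∉ys? uxs) (all-filter ∉ys? xs)) ⟩
    length ys + k               ∎
    where
    open Data.Nat.Properties.≤-Reasoning
    open import Data.List.Membership.DecPropositional _≟_ using (_∈?_)
    ∉ys? = λ z → ¬? (z ∈? ys)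
    rest = filter ∉ys? xs
    xs⊆ys++rest : xs ⊆ ys ++ rest
    xs⊆ys++rest {z} z∈xs with z ∈? ys
    ... | yes z∈ys = ∈-++⁺ˡ z∈ys
    ... | no z∉ys = ∈-++⁺ʳ ys (∈-filter⁺ ∉ys? z∈xs z∉ys)

module _ (E : FDigraph) where

  private
    _≟V_ = FDigraph._≟_ E

  ≤-size : {xs : List (V E)} → Unique xs → length xs ≤ length (allV E)
  ≤-size uxs = Unique-⊆⇒length-≤ uxs (λ {v} _ → complete E v)

  walk-1⁺ : ∀ {x y} → T (arc E x y) → T (walk E 1 x y)
  walk-1⁺ {y = y} xy = any⁺ _ (lose (complete E y) (Equivalence.from T-∧ (xy , fromWitness refl)))

  walk-1⁻ : ∀ {x y} → T (walk E 1 x y) → T (arc E x y)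
  walk-1⁻ {x} {y} w with satisfied (any⁻ _ (allV E) w)
  ... | z , xz∧z≡y with Equivalence.to T-∧ xz∧z≡y
  ... | xz , z≡y = subst (λ v → T (arc E x v)) (toWitness z≡y) xz

  walk-2⁺ : ∀ {x y z} → T (arc E x z) → T (arc E z y) → T (walk E 2 x y)
  walk-2⁺ {z = z} xz zy = any⁺ _ (lose (complete E z) (Equivalence.from T-∧ (xz , walk-1⁺ zy)))

  ∂-refl : ∀ x → ∂ E x x ≡ just 0
  ∂-refl x with length (allV E) | ≤-size {x ∷ []} ([] ∷ [])
  ... | suc _ | _ with x ≟V x
  ... | yes _ = refl
  ... | no x≢x = ⊥-elim (x≢x refl)

  ∂-arc : ∀ {x y} → x ≢ y → T (arc E x y) → ∂ E x y ≡ just 1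
  ∂-arc {x} {y} x≢y xy with length (allV E) | ≤-size {x ∷ y ∷ []} ((x≢y ∷ []) ∷ [] ∷ [])
  ... | suc (suc _) | s≤s (s≤s _) with x ≟V y | walk E 1 x y | walk-1⁺ xy
  ... | yes x≡y | _ | _ = ⊥-elim (x≢y x≡y)
  ... | no _ | true | _ = refl

  ∂-two-step : ∀ {x y z} → x ≢ y → ¬ T (arc E x y) → T (arc E x z) → T (arc E z y) → ∂ E x y ≡ just 2
  ∂-two-step {x} {y} {z} x≢y ¬xy xz zy
    with length (allV E)
       | ≤-size {x ∷ y ∷ z ∷ []} ((x≢y ∷ (λ { refl → ¬xy zy }) ∷ []) ∷ ((λ { refl → ¬xy xz }) ∷ []) ∷ [] ∷ [])
  ... | suc (suc (suc _)) | s≤s (s≤s (s≤s _))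
    with x ≟V y | walk E 1 x y | walk-1⁻ {x} {y} | walk E 2 x y | walk-2⁺ xz zy
  ... | yes x≡y | _ | _ | _ | _ = ⊥-elim (x≢y x≡y)
  ... | no _ | true | walk⇒arc | _ | _ = ⊥-elim (¬xy (walk⇒arc _))
  ... | no _ | false | _ | true | _ = refl

pattern c₀ = zero
pattern c₁ = suc zero
pattern c₂ = suc (suc zero)

record ExtendsG₁ (G : FinDigraph 3) : Set where
  field
    arc₀₁  : T (G c₀ c₁)
    arc₁₂  : T (G c₁ c₂)
    arc₂₁  : T (G c₂ c₁)
    arc₂₀  : T (G c₂ c₀)
    ¬arc₀₂ : ¬ T (G c₀ c₂)

module Composition {G : FinDigraph 3} (G⊇G₁ : ExtendsG₁ G) (t s : ℕ) where
  open ExtendsG₁ G⊇G₁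

  Γ : FDigraph
  Γ = G [K₁,K suc t ,K suc s ]

  Vertex : Set
  Vertex = V Γ

  class : Vertex → Fin 3
  class = proj₁

  apex : Vertex
  apex = c₀ , zero

  classDist : Fin 3 → Fin 3 → ℕ
  classDist c₀ c₂ = 2
  classDist c₁ c₀ = if G c₁ c₀ then 1 else 2
  classDist _  _  = 1

  classDist≢0 : ∀ i j → classDist i j ≢ 0
  classDist≢0 c₀ c₀ ()
  classDist≢0 c₀ c₁ ()
  classDist≢0 c₀ c₂ ()
  classDist≢0 c₁ c₀ with G c₁ c₀
  ... | true  = λ ()
  ... | false = λ ()
  classDist≢0 c₁ c₁ ()
  classDist≢0 c₁ c₂ ()
  classDist≢0 c₂ c₀ ()
  classDist≢0 c₂ c₁ ()
  classDist≢0 c₂ c₂ ()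

  ∂-back : ∀ x b → G c₁ c₀ ≡ b → ∂ Γ (c₁ , x) apex ≡ just (if b then 1 else 2)
  ∂-back x true  arc₁₀  = ∂-arc Γ {c₁ , x} {apex} (λ ()) (subst T (sym arc₁₀) _)
  ∂-back x false ¬arc₁₀ =
    ∂-two-step Γ {c₁ , x} {apex} {c₂ , zero} (λ ()) (λ arc₁₀ → subst T ¬arc₁₀ arc₁₀) arc₁₂ arc₂₀

  ∂-distinct : ∀ {u v} → u ≢ v → ∂ Γ u v ≡ just (classDist (class u) (class v))
  ∂-distinct {c₀ , zero} {c₀ , zero} u≢v = ⊥-elim (u≢v refl)
  ∂-distinct {c₀ , _} {c₁ , _} u≢v = ∂-arc Γ u≢v arc₀₁
  ∂-distinct {c₀ , _} {c₂ , _} u≢v = ∂-two-step Γ {z = c₁ , zero} u≢v ¬arc₀₂ arc₀₁ arc₁₂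
  ∂-distinct {c₁ , x} {c₀ , zero} u≢v = ∂-back x (G c₁ c₀) refl
  ∂-distinct {c₁ , _} {c₁ , _} u≢v = ∂-arc Γ u≢v (fromWitnessFalse (λ x≡y → u≢v (cong (c₁ ,_) x≡y)))
  ∂-distinct {c₁ , _} {c₂ , _} u≢v = ∂-arc Γ u≢v arc₁₂
  ∂-distinct {c₂ , _} {c₀ , _} u≢v = ∂-arc Γ u≢v arc₂₀
  ∂-distinct {c₂ , _} {c₁ , _} u≢v = ∂-arc Γ u≢v arc₂₁
  ∂-distinct {c₂ , _} {c₂ , _} u≢v = ∂-arc Γ u≢v (fromWitnessFalse (λ x≡y → u≢v (cong (c₂ ,_) x≡y)))

  ∂̃-distinct : ∀ {w u} → w ≢ u →
    ∂̃ Γ w u ≡ (just (classDist (class w) (class u)) , just (classDist (class u) (class w)))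
  ∂̃-distinct w≢u = cong₂ _,_ (∂-distinct w≢u) (∂-distinct (≢-sym w≢u))

  same-class-confused : ∀ {u v w} → class u ≡ class v → w ≢ u → w ≢ v → ∂̃ Γ w u ≡ ∂̃ Γ w v
  same-class-confused {w = w} cu≡cv w≢u w≢v = begin
    ∂̃ Γ w _   ≡⟨ ∂̃-distinct w≢u ⟩
    profile _ ≡⟨ cong profile cu≡cv ⟩
    profile _ ≡⟨ ∂̃-distinct w≢v ⟨
    ∂̃ Γ w _   ∎
    where
    open ≡-Reasoning
    profile = λ i → just (classDist (class w) i) , just (classDist i (class w))

  -- Apart from the apex, the vertices form a complete digraph.
  across-confused : ∀ {x y w} → w ≢ apex → w ≢ (c₁ , x) → w ≢ (c₂ , y) →
    ∂̃ Γ w (c₁ , x) ≡ ∂̃ Γ w (c₂ , y)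
  across-confused {w = c₀ , zero} w≢a _ _ = ⊥-elim (w≢a refl)
  across-confused {w = c₁ , _} _ w≢b w≢c = trans (∂̃-distinct w≢b) (sym (∂̃-distinct w≢c))
  across-confused {w = c₂ , _} _ w≢b w≢c = trans (∂̃-distinct w≢b) (sym (∂̃-distinct w≢c))

  module _ {W : List Vertex} (resolving : WeaklyResolving Γ W) where

    private
      confused-by-W : ∀ {u v} → u ≢ v → (∀ {w} → w ∈ W → ∂̃ Γ w u ≡ ∂̃ Γ w v) → ⊥
      confused-by-W u≢v confused = resolving _ _ u≢v (All.tabulate confused)

      ∈-∉⇒≢ : ∀ {u w} → u ∉ W → w ∈ W → w ≢ u
      ∈-∉⇒≢ u∉W w∈W refl = u∉W w∈W

    same-class-outside : ∀ {u v} → u ≢ v → class u ≡ class v → u ∉ W → v ∉ W → ⊥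
    same-class-outside u≢v cu≡cv u∉W v∉W = confused-by-W u≢v λ w∈W →
      same-class-confused cu≡cv (∈-∉⇒≢ u∉W w∈W) (∈-∉⇒≢ v∉W w∈W)

    across-outside : ∀ {x y} → apex ∉ W → (c₁ , x) ∉ W → (c₂ , y) ∉ W → ⊥
    across-outside a∉W b∉W c∉W = confused-by-W (λ ()) λ w∈W →
      across-confused (∈-∉⇒≢ a∉W w∈W) (∈-∉⇒≢ b∉W w∈W) (∈-∉⇒≢ c∉W w∈W)

    no-three-outside : ∀ u v w → u ≢ v → u ≢ w → v ≢ w → u ∉ W → v ∉ W → w ∉ W → ⊥
    no-three-outside (c₀ , _) (c₀ , _) _ u≢v _ _ u∉ v∉ _ = same-class-outside u≢v refl u∉ v∉
    no-three-outside (c₁ , _) (c₁ , _) _ u≢v _ _ u∉ v∉ _ = same-class-outside u≢v refl u∉ v∉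
    no-three-outside (c₂ , _) (c₂ , _) _ u≢v _ _ u∉ v∉ _ = same-class-outside u≢v refl u∉ v∉
    no-three-outside (c₀ , _) _ (c₀ , _) _ u≢w _ u∉ _ w∉ = same-class-outside u≢w refl u∉ w∉
    no-three-outside (c₁ , _) _ (c₁ , _) _ u≢w _ u∉ _ w∉ = same-class-outside u≢w refl u∉ w∉
    no-three-outside (c₂ , _) _ (c₂ , _) _ u≢w _ u∉ _ w∉ = same-class-outside u≢w refl u∉ w∉
    no-three-outside _ (c₀ , _) (c₀ , _) _ _ v≢w _ v∉ w∉ = same-class-outside v≢w refl v∉ w∉
    no-three-outside _ (c₁ , _) (c₁ , _) _ _ v≢w _ v∉ w∉ = same-class-outside v≢w refl v∉ w∉
    no-three-outside _ (c₂ , _) (c₂ , _) _ _ v≢w _ v∉ w∉ = same-class-outside v≢w refl v∉ w∉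
    no-three-outside (c₀ , zero) (c₁ , _) (c₂ , _) _ _ _ a∉ b∉ c∉ = across-outside a∉ b∉ c∉
    no-three-outside (c₀ , zero) (c₂ , _) (c₁ , _) _ _ _ a∉ c∉ b∉ = across-outside a∉ b∉ c∉
    no-three-outside (c₁ , _) (c₀ , zero) (c₂ , _) _ _ _ b∉ a∉ c∉ = across-outside a∉ b∉ c∉
    no-three-outside (c₁ , _) (c₂ , _) (c₀ , zero) _ _ _ b∉ c∉ a∉ = across-outside a∉ b∉ c∉
    no-three-outside (c₂ , _) (c₀ , zero) (c₁ , _) _ _ _ c∉ a∉ b∉ = across-outside a∉ b∉ c∉
    no-three-outside (c₂ , _) (c₁ , _) (c₀ , zero) _ _ _ c∉ b∉ a∉ = across-outside a∉ b∉ c∉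

    at-most-two-outside : ∀ {M} → Unique M → All (_∉ W) M → length M ≤ 2
    at-most-two-outside = no-three⇒length≤2 (λ {u} {v} {w} → no-three-outside u v w)

  later₁ : Fin t → Vertex
  later₁ x = c₁ , suc x

  vertex₂ : Fin (suc s) → Vertex
  vertex₂ y = c₂ , y

  W₀ : List Vertex
  W₀ = tabulate later₁ ++ tabulate vertex₂

  c₁∈W₀ : ∀ x → (c₁ , suc x) ∈ W₀
  c₁∈W₀ x = ∈-++⁺ˡ (∈-tabulate⁺ {f = later₁} x)

  c₂∈W₀ : ∀ y → (c₂ , y) ∈ W₀
  c₂∈W₀ y = ∈-++⁺ʳ (tabulate later₁) (∈-tabulate⁺ {f = vertex₂} y)

  ∈W₀⁻ : ∀ {v} → v ∈ W₀ → (∃[ x ] v ≡ (c₁ , suc x)) ⊎ (∃[ y ] v ≡ (c₂ , y))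
  ∈W₀⁻ v∈W₀ = Sum.map ∈-tabulate⁻ ∈-tabulate⁻ (∈-++⁻ (tabulate later₁) v∈W₀)

  apex∉W₀ : apex ∉ W₀
  apex∉W₀ a∈W₀ with ∈W₀⁻ a∈W₀
  ... | inj₁ (_ , ())
  ... | inj₂ (_ , ())

  c₁₀∉W₀ : (c₁ , zero) ∉ W₀
  c₁₀∉W₀ b∈W₀ with ∈W₀⁻ b∈W₀
  ... | inj₁ (_ , ())
  ... | inj₂ (_ , ())

  W₀-unique : Unique W₀
  W₀-unique = ++⁺ (tabulate⁺ {f = later₁} λ { refl → refl })
                  (tabulate⁺ {f = vertex₂} λ { refl → refl })
                  disjoint
    where
    disjoint : Disjoint (tabulate later₁) (tabulate vertex₂)
    disjoint (v∈c₁ , v∈c₂) with ∈-tabulate⁻ {f = later₁} v∈c₁ | ∈-tabulate⁻ {f = vertex₂} v∈c₂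
    ... | _ , refl | _ , ()

  length-W₀ : length W₀ ≡ suc s + suc t ∸ 1
  length-W₀ = begin
    length W₀                                            ≡⟨ length-++ (tabulate later₁) ⟩
    length (tabulate later₁) + length (tabulate vertex₂) ≡⟨ cong₂ _+_ (length-tabulate later₁)
                                                                        (length-tabulate vertex₂) ⟩
    t + suc s                                            ≡⟨ +-comm t (suc s) ⟩
    suc (s + t)                                          ≡⟨ +-suc s t ⟨
    s + suc t                                            ∎
    where open ≡-Reasoning

  member-separates : ∀ {u v W} → u ∈ W → u ≢ v → ¬ All (λ w → ∂̃ Γ w u ≡ ∂̃ Γ w v) W
  member-separates {u} {v} u∈W u≢v confused =
    classDist≢0 (class u) (class v) (just-injective (begin
      just (classDist (class u) (class v)) ≡⟨ ∂-distinct u≢v ⟨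
      ∂ Γ u v                              ≡⟨ cong proj₁ (All.lookup confused u∈W) ⟨
      ∂ Γ u u                              ≡⟨ ∂-refl Γ u ⟩
      just 0                               ∎))
    where open ≡-Reasoning

  apex-c₁₀-separated : ∂̃ Γ (c₂ , zero) apex ≢ ∂̃ Γ (c₂ , zero) (c₁ , zero)
  apex-c₁₀-separated same with begin
      just 2                      ≡⟨ ∂-distinct {apex} {c₂ , zero} (λ ()) ⟨
      ∂ Γ apex (c₂ , zero)        ≡⟨ cong proj₂ same ⟩
      ∂ Γ (c₁ , zero) (c₂ , zero) ≡⟨ ∂-distinct {c₁ , zero} {c₂ , zero} (λ ()) ⟩
      just 1                      ∎
    where open ≡-Reasoning
  ... | ()

  W₀-resolving : WeaklyResolving Γ W₀
  W₀-resolving (c₁ , suc x) _ u≢v = member-separates (c₁∈W₀ x) u≢v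
  W₀-resolving (c₂ , y) _ u≢v = member-separates (c₂∈W₀ y) u≢v
  W₀-resolving _ (c₁ , suc x) u≢v = member-separates (c₁∈W₀ x) (≢-sym u≢v) ∘ All.map sym
  W₀-resolving _ (c₂ , y) u≢v = member-separates (c₂∈W₀ y) (≢-sym u≢v) ∘ All.map sym
  W₀-resolving (c₀ , zero) (c₀ , zero) u≢v = ⊥-elim (u≢v refl)
  W₀-resolving (c₁ , zero) (c₁ , zero) u≢v = ⊥-elim (u≢v refl)
  W₀-resolving (c₀ , zero) (c₁ , zero) _ confused =
    apex-c₁₀-separated (All.lookup confused (c₂∈W₀ zero))
  W₀-resolving (c₁ , zero) (c₀ , zero) _ confused =
    apex-c₁₀-separated (sym (All.lookup confused (c₂∈W₀ zero)))

  -- apex ∷ (c₁ , zero) ∷ W₀ lists distinct vertices, at most two of which lie outside W.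
  W₀-minimal : ∀ {W} → WeaklyResolving Γ W → length W₀ ≤ length W
  W₀-minimal {W} resolving = s≤s⁻¹ (s≤s⁻¹ (begin
    2 + length W₀  ≤⟨ length≤length+complement (FDigraph._≟_ Γ) (apex ∷ (c₁ , zero) ∷ W₀) W
                        unique (at-most-two-outside resolving) ⟩
    length W + 2   ≡⟨ +-comm (length W) 2 ⟩
    2 + length W   ∎))
    where
    open Data.Nat.Properties.≤-Reasoning
    unique : Unique (apex ∷ (c₁ , zero) ∷ W₀)
    unique = ((λ ()) ∷ ¬Any⇒All¬ W₀ apex∉W₀) ∷ ¬Any⇒All¬ W₀ c₁₀∉W₀ ∷ W₀-unique

  dim : WeakMetricDim≡ Γ (suc s + suc t ∸ 1)
  dim = (W₀ , W₀-unique , W₀-resolving , length-W₀) ,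
        λ W _ resolving → subst (_≤ length W) length-W₀ (W₀-minimal resolving)

G₁-extends : ExtendsG₁ G₁
G₁-extends = record { arc₀₁ = _ ; arc₁₂ = _ ; arc₂₁ = _ ; arc₂₀ = _ ; ¬arc₀₂ = λ () }

G₂-extends : ExtendsG₁ G₂
G₂-extends = record { arc₀₁ = _ ; arc₁₂ = _ ; arc₂₁ = _ ; arc₂₀ = _ ; ¬arc₀₂ = λ () }

lemma4p3 : (t s : ℕ) → 1 Data.Nat.≤ t → 1 Data.Nat.≤ s →
    (G : FinDigraph 3) → G ≡ G₁ ⊎ G ≡ G₂ →
    WeakMetricDim≡ (G [K₁,K t ,K s ]) (s + t ∸ 1)
lemma4p3 (suc t) (suc s) (s≤s z≤n) (s≤s z≤n) G (inj₁ refl) = Composition.dim G₁-extends t s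
lemma4p3 (suc t) (suc s) (s≤s z≤n) (s≤s z≤n) G (inj₂ refl) = Composition.dim G₂-extends t s
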